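{- Let $1<d_1<d_2<d_3$ be integers with $\gcd(d_1,d_2)=1$ such that $\{d_1,d_2,d_3\}$ is a minimal generating set of the semigroup $S(d_1,d_2,d_3)$. Let $a_{33}=\min\{v\ge2: vd_3=v_1d_1+v_2d_2,\ v_1,v_2\in\mathbb Z_{\ge0}\}$. For $1\le k<a_{33}$, write $kd_3=d_1d_2-p_{kd_3}d_1-q_{kd_3}d_2$ with integers $p_{kd_3},q_{kd_3}\ge1$, and set $$\Omega^k=\{u_1d_1+u_2d_2+kd_3:\ 0\le u_1\le p_{kd_3}-1,\ 0\le u_2\le q_{kd_3}-1\}.$$ If $\bar\sigma\in\Delta(d_1,d_2)$ is representable as a nonnegative integer combination of $d_1,d_2,d_3$, then $\bar\sigma\in\Omega^k$ for at least one $k$ with $1\le k<a_{33}$.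
   Context: $S(d_1,d_2,d_3)$ is the set of nonnegative integer combinations of $d_1,d_2,d_3$; minimal means no $d_i$ is a nonnegative integer combination of the other two. $\Delta(d_1,d_2)$ is the set of positive integers not representable as nonnegative integer combinations of $d_1,d_2$. For $\gcd(d_1,d_2)=1$, every $t\in\Delta(d_1,d_2)$ has a unique representation $t=d_1d_2-pd_1-qd_2$ with $1\le p\le\lfloor d_2-d_2/d_1\rfloor$, $1\le q\le d_1-1$; and $kd_3\in\Delta(d_1,d_2)$ for $1\le k<a_{33}$, so $p_{kd_3},q_{kd_3}$ are well defined. -}

module Defs where

open import Data.Nat using (ℕ; _+_; _*_; _≤_; _<_)
open import Data.Product using (Σ; _×_; ∃-syntax)
open import Relation.Binary.PropositionalEquality using (_≡_)
open import Relation.Nullary using (¬_)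

InS₂ : ℕ → ℕ → ℕ → Set
InS₂ d₁ d₂ n = ∃[ a ] ∃[ b ] n ≡ a * d₁ + b * d₂

InS₃ : ℕ → ℕ → ℕ → ℕ → Set
InS₃ d₁ d₂ d₃ n = ∃[ a ] ∃[ b ] ∃[ c ] n ≡ a * d₁ + b * d₂ + c * d₃

Minimal : ℕ → ℕ → ℕ → Set
Minimal d₁ d₂ d₃ = ¬ InS₂ d₂ d₃ d₁ × ¬ InS₂ d₁ d₃ d₂ × ¬ InS₂ d₁ d₂ d₃

InΔ : ℕ → ℕ → ℕ → Set
InΔ d₁ d₂ t = 1 ≤ t × ¬ InS₂ d₁ d₂ t

IsA33 : ℕ → ℕ → ℕ → ℕ → Set
IsA33 d₁ d₂ d₃ a =
  (2 ≤ a × InS₂ d₁ d₂ (a * d₃)) ×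
  (∀ v → 2 ≤ v → InS₂ d₁ d₂ (v * d₃) → a ≤ v)

-- σ ∈ Ω^k, where p, q are p_{kd₃}, q_{kd₃}
InΩ : ℕ → ℕ → ℕ → ℕ → ℕ → ℕ → ℕ → Set
InΩ d₁ d₂ d₃ k p q σ =
  ∃[ u₁ ] ∃[ u₂ ] (u₁ < p × u₂ < q × σ ≡ u₁ * d₁ + u₂ * d₂ + k * d₃)

{-# OPTIONS --safe #-}
module Submission where

-- Since a₃₃ d₃ ∈ S(d₁,d₂), the d₃-coefficient of σ can be reduced modulo a₃₃, giving
-- σ = A d₁ + B d₂ + k d₃ with k < a₃₃. As σ ∉ S(d₁,d₂), neither is k d₃; so k ≥ 1 and, by
-- coprimality, k d₃ + p d₁ + q d₂ = d₁ d₂ with p ≤ d₂ and q < d₁. Then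
-- σ + p d₁ + q d₂ = A d₁ + B d₂ + d₁ d₂, and A ≥ p (or B ≥ q) would let p d₁ + q d₂ cancel
-- against part of d₁ d₂, exhibiting σ ∈ S(d₁,d₂).

open import Defs
open import Data.Nat using (ℕ; suc; _+_; _*_; _∸_; _≤_; _<_; NonZero; >-nonZero)
open import Data.Nat.Properties
open import Algebra.Properties.CommutativeSemigroup +-commutativeSemigroup using (xy∙z≈xz∙y)
open import Data.Nat.GCD using (gcd; module Bézout)
open import Data.Nat.Coprimality using (Coprime; coprime-Bézout; gcd≡1⇒coprime)
open import Data.Nat.DivMod using (_%_; _/_; m≡m%n+[m/n]*n; m%n<n)
open import Data.Nat.Divisibility using (_∣_; divides; ∣m+n∣m⇒∣n; ∣n⇒∣m*n; n∣m*n)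
open import Data.Nat.Tactic.RingSolver using (solve)
open import Data.List using ([]; _∷_)
open import Data.Product using (_×_; ∃-syntax; _,_)
open import Function using (_∘_)
open import Relation.Nullary using (¬_)
open import Relation.Binary.PropositionalEquality
open ≡-Reasoning

InS₂-swap : ∀ {d₁ d₂ n} → InS₂ d₁ d₂ n → InS₂ d₂ d₁ n
InS₂-swap {d₁} {d₂} (a , b , n≡) = b , a , trans n≡ (+-comm (a * d₁) (b * d₂))

InS₂-+ : ∀ {d₁ d₂ m n} → InS₂ d₁ d₂ m → InS₂ d₁ d₂ n → InS₂ d₁ d₂ (m + n)
InS₂-+ {d₁} {d₂} (a , b , refl) (a′ , b′ , refl) =
  a + a′ , b + b′ , solve (a ∷ b ∷ a′ ∷ b′ ∷ d₁ ∷ d₂ ∷ [])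

InS₂-* : ∀ {d₁ d₂ n} s → InS₂ d₁ d₂ n → InS₂ d₁ d₂ (s * n)
InS₂-* {d₁} {d₂} s (a , b , refl) = s * a , s * b , solve (s ∷ a ∷ b ∷ d₁ ∷ d₂ ∷ [])

-- Write A = p + e and d₁ = q + f; cancelling p d₁ + q d₂ leaves t = e d₁ + (B + f) d₂.
p≤A⇒InS₂ : ∀ {d₁ d₂ t p q A B} → q ≤ d₁ →
  t + p * d₁ + q * d₂ ≡ A * d₁ + B * d₂ + d₁ * d₂ → p ≤ A → InS₂ d₁ d₂ t
p≤A⇒InS₂ {d₂ = d₂} {t} {p} {q} {B = B} q≤d₁ eq p≤A
  with m≤n⇒∃[o]m+o≡n q≤d₁ | m≤n⇒∃[o]m+o≡n p≤A
... | f , refl | e , refl = e , B + f , +-cancelʳ-≡ (p * (q + f) + q * d₂) t _ (begin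
  t + (p * (q + f) + q * d₂)                     ≡⟨ solve (t ∷ p ∷ q ∷ f ∷ d₂ ∷ []) ⟩
  t + p * (q + f) + q * d₂                       ≡⟨ eq ⟩
  (p + e) * (q + f) + B * d₂ + (q + f) * d₂      ≡⟨ solve (p ∷ e ∷ q ∷ f ∷ B ∷ d₂ ∷ []) ⟩
  e * (q + f) + (B + f) * d₂ + (p * (q + f) + q * d₂) ∎)

¬InS₂⇒<ˡ : ∀ {d₁ d₂ t p q A B} → ¬ InS₂ d₁ d₂ t → q ≤ d₁ →
  t + p * d₁ + q * d₂ ≡ A * d₁ + B * d₂ + d₁ * d₂ → A < p
¬InS₂⇒<ˡ {B = B} t∉S q≤d₁ eq = ≰⇒> (t∉S ∘ p≤A⇒InS₂ {B = B} q≤d₁ eq)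

¬InS₂⇒<ʳ : ∀ {d₁ d₂ t p q A B} → ¬ InS₂ d₁ d₂ t → p ≤ d₂ →
  t + p * d₁ + q * d₂ ≡ A * d₁ + B * d₂ + d₁ * d₂ → B < q
¬InS₂⇒<ʳ {d₁} {d₂} {t} {p} {q} {A} {B} t∉S p≤d₂ eq =
  ¬InS₂⇒<ˡ {A = B} {B = A} (t∉S ∘ InS₂-swap) p≤d₂ (begin
    t + q * d₂ + p * d₁           ≡⟨ solve (t ∷ p ∷ q ∷ d₁ ∷ d₂ ∷ []) ⟩
    t + p * d₁ + q * d₂           ≡⟨ eq ⟩
    A * d₁ + B * d₂ + d₁ * d₂     ≡⟨ solve (A ∷ B ∷ d₁ ∷ d₂ ∷ []) ⟩
    B * d₂ + A * d₁ + d₂ * d₁     ∎)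

-- In the second Bézout case y n ≡ 1 (mod m), so (m − 1) y is the witness.
coprime-negInverse : ∀ {m n} .{{_ : NonZero m}} → Coprime m n → ∃[ y ] m ∣ 1 + y * n
coprime-negInverse {suc e} {n} coprime with coprime-Bézout coprime
... | Bézout.+- x y 1+yn≡xm = y , divides x 1+yn≡xm
... | Bézout.-+ x y 1+xm≡yn = e * y , divides (1 + e * x) (begin
  1 + e * y * n                 ≡⟨ cong (1 +_) (*-assoc e y n) ⟩
  1 + e * (y * n)               ≡⟨ cong (λ z → 1 + e * z) 1+xm≡yn ⟨
  1 + e * (1 + x * suc e)       ≡⟨ solve (e ∷ x ∷ []) ⟩
  (1 + e * x) * suc e           ∎)

coprime-congruence : ∀ {m n} .{{_ : NonZero m}} → Coprime m n →
  ∀ t → ∃[ q ] (q < m × m ∣ t + q * n)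
coprime-congruence {m} {n} coprime t with coprime-negInverse coprime
... | y , m∣1+yn = t * y % m , m%n<n (t * y) m ,
  ∣m+n∣m⇒∣n (subst (m ∣_) (regroup (t * y % m) (t * y / m) (m≡m%n+[m/n]*n (t * y) m))
                    (∣n⇒∣m*n t m∣1+yn))
            (n∣m*n (t * y / m * n))
  where
  regroup : ∀ r s → t * y ≡ r + s * m → t * (1 + y * n) ≡ s * n * m + (t + r * n)
  regroup r s ty≡r+sm = begin
    t * (1 + y * n)            ≡⟨ solve (t ∷ y ∷ n ∷ []) ⟩
    t + t * y * n              ≡⟨ cong (λ z → t + z * n) ty≡r+sm ⟩
    t + (r + s * m) * n        ≡⟨ solve (t ∷ r ∷ s ∷ m ∷ n ∷ []) ⟩
    s * n * m + (t + r * n)    ∎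

¬InS₂-representation : ∀ {d₁ d₂ t} .{{_ : NonZero d₁}} → Coprime d₁ d₂ → ¬ InS₂ d₁ d₂ t →
  ∃[ p ] ∃[ q ] (1 ≤ p × 1 ≤ q × q < d₁ × p ≤ d₂ × t + p * d₁ + q * d₂ ≡ d₁ * d₂)
¬InS₂-representation {d₁} {d₂} {t} coprime t∉S with coprime-congruence coprime t
... | q , q<d₁ , divides m t+qd₂≡md₁ =
  d₂ ∸ m , q , m<n⇒0<n∸m m<d₂ , ¬InS₂⇒<ʳ {A = m} t∉S ≤-refl shifted , q<d₁ , m∸n≤m d₂ m ,
  (begin
    t + (d₂ ∸ m) * d₁ + q * d₂    ≡⟨ xy∙z≈xz∙y t ((d₂ ∸ m) * d₁) (q * d₂) ⟩
    t + q * d₂ + (d₂ ∸ m) * d₁    ≡⟨ cong (_+ (d₂ ∸ m) * d₁) t+qd₂≡md₁ ⟩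
    m * d₁ + (d₂ ∸ m) * d₁        ≡⟨ *-distribʳ-+ d₁ m (d₂ ∸ m) ⟨
    (m + (d₂ ∸ m)) * d₁           ≡⟨ cong (_* d₁) (m+[n∸m]≡n (<⇒≤ m<d₂)) ⟩
    d₂ * d₁                       ≡⟨ *-comm d₂ d₁ ⟩
    d₁ * d₂                       ∎)
  where
  -- Adding d₁ d₂ to t + q d₂ = m d₁ gives the shape of ¬InS₂⇒<ˡ/ʳ with p = d₂, A = m, B = 0.
  shifted : t + d₂ * d₁ + q * d₂ ≡ m * d₁ + 0 * d₂ + d₁ * d₂
  shifted = begin
    t + d₂ * d₁ + q * d₂          ≡⟨ solve (t ∷ q ∷ d₁ ∷ d₂ ∷ []) ⟩
    t + q * d₂ + d₁ * d₂          ≡⟨ cong (_+ d₁ * d₂) t+qd₂≡md₁ ⟩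
    m * d₁ + d₁ * d₂              ≡⟨ cong (_+ d₁ * d₂) (+-identityʳ (m * d₁)) ⟨
    m * d₁ + 0 * d₂ + d₁ * d₂     ∎

  m<d₂ : m < d₂
  m<d₂ = ¬InS₂⇒<ˡ {B = 0} t∉S (<⇒≤ q<d₁) shifted

InS₃-reduce : ∀ {d₁ d₂ d₃ n σ} .{{_ : NonZero n}} → InS₂ d₁ d₂ (n * d₃) → InS₃ d₁ d₂ d₃ σ →
  ∃[ k ] (k < n × ∃[ A ] ∃[ B ] σ ≡ A * d₁ + B * d₂ + k * d₃)
InS₃-reduce {d₁} {d₂} {d₃} {n} nd₃∈S (a , b , c , refl) =
  c % n , m%n<n c n , reduce (c % n) (c / n) (m≡m%n+[m/n]*n c n)
  where
  reduce : ∀ r s → c ≡ r + s * n → ∃[ A ] ∃[ B ] a * d₁ + b * d₂ + c * d₃ ≡ A * d₁ + B * d₂ + r * d₃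
  reduce r s c≡r+sn with InS₂-+ (a , b , refl) (InS₂-* s nd₃∈S)
  ... | A , B , eq = A , B , (begin
    a * d₁ + b * d₂ + c * d₃                 ≡⟨ cong (λ z → a * d₁ + b * d₂ + z * d₃) c≡r+sn ⟩
    a * d₁ + b * d₂ + (r + s * n) * d₃       ≡⟨ solve (a ∷ b ∷ r ∷ s ∷ n ∷ d₁ ∷ d₂ ∷ d₃ ∷ []) ⟩
    a * d₁ + b * d₂ + s * (n * d₃) + r * d₃  ≡⟨ cong (_+ r * d₃) eq ⟩
    A * d₁ + B * d₂ + r * d₃                 ∎)

¬InS₂⇒InΩ : ∀ {d₁ d₂ d₃ k p q A B} → ¬ InS₂ d₁ d₂ (A * d₁ + B * d₂ + k * d₃) →
  q ≤ d₁ → p ≤ d₂ → k * d₃ + p * d₁ + q * d₂ ≡ d₁ * d₂ →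
  InΩ d₁ d₂ d₃ k p q (A * d₁ + B * d₂ + k * d₃)
¬InS₂⇒InΩ {d₁} {d₂} {d₃} {k} {p} {q} {A} {B} σ∉S q≤d₁ p≤d₂ kd₃+pd₁+qd₂≡d₁d₂ =
  A , B , ¬InS₂⇒<ˡ {B = B} σ∉S q≤d₁ shifted , ¬InS₂⇒<ʳ {A = A} σ∉S p≤d₂ shifted , refl
  where
  shifted : A * d₁ + B * d₂ + k * d₃ + p * d₁ + q * d₂ ≡ A * d₁ + B * d₂ + d₁ * d₂
  shifted = begin
    A * d₁ + B * d₂ + k * d₃ + p * d₁ + q * d₂    ≡⟨ solve (A ∷ B ∷ k ∷ p ∷ q ∷ d₁ ∷ d₂ ∷ d₃ ∷ []) ⟩
    A * d₁ + B * d₂ + (k * d₃ + p * d₁ + q * d₂)  ≡⟨ cong (A * d₁ + B * d₂ +_) kd₃+pd₁+qd₂≡d₁d₂ ⟩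
    A * d₁ + B * d₂ + d₁ * d₂                     ∎

theorem1 : (d₁ d₂ d₃ : ℕ) → 1 < d₁ → d₁ < d₂ → d₂ < d₃ → gcd d₁ d₂ ≡ 1 →
    Minimal d₁ d₂ d₃ → (a₃₃ : ℕ) → IsA33 d₁ d₂ d₃ a₃₃ →
    (σ : ℕ) → InΔ d₁ d₂ σ → InS₃ d₁ d₂ d₃ σ →
    ∃[ k ] ∃[ p ] ∃[ q ]
      (1 ≤ k × k < a₃₃ × 1 ≤ p × 1 ≤ q ×
       k * d₃ + p * d₁ + q * d₂ ≡ d₁ * d₂ ×
       InΩ d₁ d₂ d₃ k p q σ)
theorem1 d₁ d₂ d₃ 1<d₁ _ _ gcd≡1 _ a₃₃ ((2≤a₃₃ , a₃₃d₃∈S) , _) σ (_ , σ∉S) σ∈S₃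
  with InS₃-reduce {{>-nonZero (<⇒≤ 2≤a₃₃)}} a₃₃d₃∈S σ∈S₃
... | k , k<a₃₃ , A , B , refl =
  let kd₃∉S = σ∉S ∘ InS₂-+ (A , B , refl)
      p , q , 1≤p , 1≤q , q<d₁ , p≤d₂ , kd₃+pd₁+qd₂≡d₁d₂ =
        ¬InS₂-representation {{>-nonZero (<⇒≤ 1<d₁)}} (gcd≡1⇒coprime gcd≡1) kd₃∉S
  in k , p , q , n≢0⇒n>0 (λ k≡0 → kd₃∉S (0 , 0 , cong (_* d₃) k≡0)) , k<a₃₃ , 1≤p , 1≤q ,
     kd₃+pd₁+qd₂≡d₁d₂ , ¬InS₂⇒InΩ {k = k} {A = A} {B = B} σ∉S (<⇒≤ q<d₁) p≤d₂ kd₃+pd₁+qd₂≡d₁d₂
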